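{- Let $n\ge 1$ and $t\ge 1$ be integers, and let $[n]=\{0,1,\ldots,n-1\}$. Let $F_1,\dots,F_t$ be $t$ mutually orthogonal Latin squares of order $n$, each indexed by $[n]$ (so $F_k(r,c)\in[n]$ denotes the symbol in row $r$, column $c$ of $F_k$), and let $L$ be a Latin square of order $n$ indexed by $[n]$. Define the following arrays, whose rows, columns and symbols are indexed by $[n]\times[n]$: \begin{align*} {\cal X}_k&=\{((p,r),(q,c),(F_k(F_1(p,r),q),\,F_k(F_1(p,q),c)))\mid 0\le p,q,r,c\le n-1\},\quad 1\le k\le t,\\ {\cal B}&=\{((p,r),(q,c),(F_1(p,q),\,L(F_1(p,r),c)))\mid 0\le p,q,r,c\le n-1\}, \end{align*} where a triple $((p,r),(q,c),(x,y))$ means that symbol $(x,y)$ is in row $(p,r)$, column $(q,c)$. Then ${\cal B},{\cal X}_1,\dots,{\cal X}_t$ form a set of $t+1$ mutually orthogonal Latin squares of order $n^2$.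
   Context: A Latin square of order $n$ on a set $N$ with $|N|=n$ is a set $P\subseteq N\times N\times N$ of $n^2$ triples (row, column, symbol) such that any two coordinates of a triple determine the third; we write $P(r,c)=e$ if $(r,c,e)\in P$. Two Latin squares $P,Q$ of the same order are orthogonal if for any two distinct cells $(r_1,c_1),(r_2,c_2)$, it is not the case that both $P(r_1,c_1)=P(r_2,c_2)$ and $Q(r_1,c_1)=Q(r_2,c_2)$. A set of Latin squares is mutually orthogonal if its members are pairwise orthogonal. -}

module Defs where

open import Data.Nat using (ℕ; suc)
open import Data.Fin using (Fin; zero; suc)
open import Data.Product using (_×_; _,_)
open import Relation.Binary.PropositionalEquality using (_≡_)
open import Relation.Nullary using (¬_)

-- A square on symbol/index set N: the function r c ↦ P(r,c), i.e. the set of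
-- triples {(r,c,P r c)}; rows and columns determine the symbol by construction.
Square : Set → Set
Square N = N → N → N

IsLatin : {N : Set} → Square N → Set
IsLatin {N} P =
  (∀ (r c₁ c₂ : N) → P r c₁ ≡ P r c₂ → c₁ ≡ c₂) ×
  (∀ (r₁ r₂ c : N) → P r₁ c ≡ P r₂ c → r₁ ≡ r₂)

Orthogonal : {N : Set} → Square N → Square N → Set
Orthogonal {N} P Q =
  ∀ (r₁ c₁ r₂ c₂ : N) → ¬ ((r₁ , c₁) ≡ (r₂ , c₂)) →
  ¬ (P r₁ c₁ ≡ P r₂ c₂ × Q r₁ c₁ ≡ Q r₂ c₂)

IsMOLS : {N : Set} (m : ℕ) → (Fin m → Square N) → Set
IsMOLS {N} m F =
  (∀ i → IsLatin (F i)) ×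
  (∀ i j → ¬ (i ≡ j) → Orthogonal (F i) (F j))

-- The arrays of the theorem (index 0 plays the role of F_1).
Xsq : {n t : ℕ} → (Fin (suc t) → Square (Fin n)) → Fin (suc t) → Square (Fin n × Fin n)
Xsq F k (p , r) (q , c) = F k (F zero p r) q , F k (F zero p q) c

Bsq : {n t : ℕ} → (Fin (suc t) → Square (Fin n)) → Square (Fin n) → Square (Fin n × Fin n)
Bsq F L (p , r) (q , c) = F zero p q , L (F zero p r) c

BXfamily : {n t : ℕ} → (Fin (suc t) → Square (Fin n)) → Square (Fin n) →
           Fin (suc (suc t)) → Square (Fin n × Fin n)
BXfamily F L zero = Bsq F L
BXfamily F L (suc k) = Xsq F k

module Submission where

open import Defs
open import Data.Nat using (ℕ; suc)
open import Data.Fin using (Fin; zero; suc)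
open import Data.Fin.Properties using (_≟_)
open import Data.Product using (_×_; _,_)
open import Data.Product.Properties using (≡-dec; ,-injectiveˡ; ,-injectiveʳ)
open import Function using (_∘_)
open import Relation.Binary.Definitions using (DecidableEquality)
open import Relation.Binary.PropositionalEquality using (_≡_; refl; cong; cong₂)
open import Relation.Nullary using (¬_; contradiction)
open import Relation.Nullary.Decidable using (decidable-stable)

-- For a cell ((p,r),(q,c)) put a = F₁(p,r) and b = F₁(p,q). Each
-- entry of B and of every X_k is a function of the pairs (a,q) and (b,c), and
-- conversely q and b recover p (F₁ is Latin in its columns), after which a
-- recovers r. So it suffices to recover (a,q) and (b,c) from the entries, and
-- this is exactly what the Latin property of L and the F_k and the orthogonality
-- of distinct F_i, F_j provide.

module _ {N : Set} {P : Square N} where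

  latin-row-injective : IsLatin P → ∀ {r₁ r₂ c₁ c₂} →
                        r₁ ≡ r₂ → P r₁ c₁ ≡ P r₂ c₂ → c₁ ≡ c₂
  latin-row-injective (rows , _) refl = rows _ _ _

  latin-col-injective : IsLatin P → ∀ {r₁ r₂ c₁ c₂} →
                        c₁ ≡ c₂ → P r₁ c₁ ≡ P r₂ c₂ → r₁ ≡ r₂
  latin-col-injective (_ , cols) refl = cols _ _ _

  latin-pair-injective : IsLatin P → ∀ {p p′ q q′ r r′} →
                         q ≡ q′ → P p q ≡ P p′ q′ → P p r ≡ P p′ r′ → (p , r) ≡ (p′ , r′)
  latin-pair-injective latin q≡q′ pq≡ pr≡ with latin-col-injective latin q≡q′ pq≡
  ... | refl = cong (_ ,_) (latin-row-injective latin refl pr≡)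

SuperpositionInjective : {N : Set} → Square N → Square N → Set
SuperpositionInjective P Q =
  ∀ {r₁ c₁ r₂ c₂} → P r₁ c₁ ≡ P r₂ c₂ → Q r₁ c₁ ≡ Q r₂ c₂ → (r₁ , c₁) ≡ (r₂ , c₂)

module _ {N : Set} {P Q : Square N} where

  superpositionInjective⇒orthogonal : SuperpositionInjective P Q → Orthogonal P Q
  superpositionInjective⇒orthogonal inj _ _ _ _ cells≢ (P≡ , Q≡) = cells≢ (inj P≡ Q≡)

  orthogonal⇒superpositionInjective : DecidableEquality N → Orthogonal P Q →
                                      SuperpositionInjective P Q
  orthogonal⇒superpositionInjective _≟ᴺ_ orth {r₁} {c₁} {r₂} {c₂} P≡ Q≡ =
    decidable-stable (≡-dec _≟ᴺ_ _≟ᴺ_ (r₁ , c₁) (r₂ , c₂))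
      (λ cells≢ → orth r₁ c₁ r₂ c₂ cells≢ (P≡ , Q≡))

  orthogonal-sym : Orthogonal P Q → Orthogonal Q P
  orthogonal-sym orth r₁ c₁ r₂ c₂ cells≢ (Q≡ , P≡) = orth r₁ c₁ r₂ c₂ cells≢ (P≡ , Q≡)

module _ {n t : ℕ} (F : Fin (suc t) → Square (Fin n)) where

  Xsq-latin : ∀ k → IsLatin (F zero) → IsLatin (F k) → IsLatin (Xsq F k)
  Xsq-latin k latin₁ latinₖ = rows , cols
    where
    rows : ∀ (r c c′ : Fin n × Fin n) → Xsq F k r c ≡ Xsq F k r c′ → c ≡ c′
    rows (p , r) (q , c) (q′ , c′) X≡ =
      cong₂ _,_ q≡q′ (latin-row-injective latinₖ (cong (F zero p) q≡q′) (,-injectiveʳ X≡))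
      where
      q≡q′ : q ≡ q′
      q≡q′ = latin-row-injective latinₖ refl (,-injectiveˡ X≡)
    cols : ∀ (r r′ c : Fin n × Fin n) → Xsq F k r c ≡ Xsq F k r′ c → r ≡ r′
    cols (p , r) (p′ , r′) (q , c) X≡ =
      latin-pair-injective latin₁ refl
        (latin-col-injective latinₖ refl (,-injectiveʳ X≡))
        (latin-col-injective latinₖ refl (,-injectiveˡ X≡))

  Bsq-latin : (L : Square (Fin n)) → IsLatin (F zero) → IsLatin L → IsLatin (Bsq F L)
  Bsq-latin L latin₁ latinL = rows , cols
    where
    rows : ∀ (r c c′ : Fin n × Fin n) → Bsq F L r c ≡ Bsq F L r c′ → c ≡ c′
    rows (p , r) (q , c) (q′ , c′) B≡ =
      cong₂ _,_ (latin-row-injective latin₁ refl (,-injectiveˡ B≡))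
                (latin-row-injective latinL refl (,-injectiveʳ B≡))
    cols : ∀ (r r′ c : Fin n × Fin n) → Bsq F L r c ≡ Bsq F L r′ c → r ≡ r′
    cols (p , r) (p′ , r′) (q , c) B≡ =
      latin-pair-injective latin₁ refl (,-injectiveˡ B≡)
        (latin-col-injective latinL refl (,-injectiveʳ B≡))

  Xsq-superpositionInjective : ∀ i j → IsLatin (F zero) →
                               SuperpositionInjective (F i) (F j) →
                               SuperpositionInjective (Xsq F i) (Xsq F j)
  Xsq-superpositionInjective i j latin₁ inj {p , r} {q , c} {p′ , r′} {q′ , c′} Xᵢ≡ Xⱼ≡ =
    cong₂ _,_ (latin-pair-injective latin₁ q≡q′ (,-injectiveˡ bc≡) (,-injectiveˡ aq≡))
              (cong₂ _,_ q≡q′ (,-injectiveʳ bc≡))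
    where
    aq≡ : (F zero p r , q) ≡ (F zero p′ r′ , q′)
    aq≡ = inj (,-injectiveˡ Xᵢ≡) (,-injectiveˡ Xⱼ≡)
    bc≡ : (F zero p q , c) ≡ (F zero p′ q′ , c′)
    bc≡ = inj (,-injectiveʳ Xᵢ≡) (,-injectiveʳ Xⱼ≡)
    q≡q′ : q ≡ q′
    q≡q′ = ,-injectiveʳ aq≡

  Bsq-Xsq-superpositionInjective : ∀ k (L : Square (Fin n)) →
                                   IsLatin (F zero) → IsLatin (F k) → IsLatin L →
                                   SuperpositionInjective (Bsq F L) (Xsq F k)
  Bsq-Xsq-superpositionInjective k L latin₁ latinₖ latinL
                                 {p , r} {q , c} {p′ , r′} {q′ , c′} B≡ X≡ =
    cong₂ _,_ (latin-pair-injective latin₁ q≡q′ b≡b′ a≡a′) (cong₂ _,_ q≡q′ c≡c′)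
    where
    b≡b′ : F zero p q ≡ F zero p′ q′
    b≡b′ = ,-injectiveˡ B≡
    c≡c′ : c ≡ c′
    c≡c′ = latin-row-injective latinₖ b≡b′ (,-injectiveʳ X≡)
    a≡a′ : F zero p r ≡ F zero p′ r′
    a≡a′ = latin-col-injective latinL c≡c′ (,-injectiveʳ B≡)
    q≡q′ : q ≡ q′
    q≡q′ = latin-row-injective latinₖ a≡a′ (,-injectiveˡ X≡)

mainTheorem1 : (n t : ℕ) → (F : Fin (suc t) → Square (Fin (suc n))) → (L : Square (Fin (suc n))) →
    IsMOLS (suc t) F → IsLatin L → IsMOLS (suc (suc t)) (BXfamily F L)
mainTheorem1 n t F L (latinF , orthF) latinL = latin , orth
  where
  latin : ∀ i → IsLatin (BXfamily F L i)
  latin zero    = Bsq-latin F L (latinF zero) latinL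
  latin (suc k) = Xsq-latin F k (latinF zero) (latinF k)

  B⊥X : ∀ k → Orthogonal (Bsq F L) (Xsq F k)
  B⊥X k = superpositionInjective⇒orthogonal
            (Bsq-Xsq-superpositionInjective F k L (latinF zero) (latinF k) latinL)

  orth : ∀ i j → ¬ i ≡ j → Orthogonal (BXfamily F L i) (BXfamily F L j)
  orth zero    zero    i≢j = contradiction refl i≢j
  orth zero    (suc k) _   = B⊥X k
  orth (suc k) zero    _   = orthogonal-sym (B⊥X k)
  orth (suc i) (suc j) i≢j =
    superpositionInjective⇒orthogonal
      (Xsq-superpositionInjective F i j (latinF zero)
        (orthogonal⇒superpositionInjective _≟_ (orthF i j (i≢j ∘ cong suc))))
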